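{- Let $T$ be a tournament on $n$ vertices whose minimum feedback arc set has size $k \ge 1$, let $t = 3\sqrt{k}$ and $d = 12\sqrt{k}$, and let $B$ be the set of bad vertices of $T$ with respect to $t$. For each $i \in \{0,\dots,n-1\}$ let $C(i)$ be the set of vertices whose indegree lies in $[i-d, i+d]$ together with all vertices of $B$. Then $|C(i)| \le 52\sqrt{k}$ for every $i$.
   Context: A tournament is a directed graph in which every pair of distinct vertices is joined by exactly one arc. A feedback arc set is a set of arcs whose removal leaves an acyclic digraph. The indegree of a vertex is the number of arcs directed into it. Three vertices form a triangle if the three arcs among them form a directed cycle. An arc is a major suspect if it belongs to at least $t$ triangles. A vertex is bad if at least $t$ arcs incident with it are major suspects. -}

module Defs where

open import Data.Nat using (ℕ; _+_; _*_; _≤_; _≤ᵇ_; ∣_-_∣)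
open import Data.Bool using (Bool; true; false; if_then_else_; _∧_; _∨_; not)
open import Data.Fin using (Fin; toℕ)
open import Data.List using (map; allFin)
open import Data.Nat.ListAction using (sum)
open import Data.Product using (Σ; _×_)
open import Relation.Binary.PropositionalEquality using (_≡_; _≢_)
open import Relation.Binary.Construct.Closure.Transitive using (TransClosure)
open import Relation.Nullary using (¬_)

Digraph : ℕ → Set
Digraph n = Fin n → Fin n → Bool

count : ∀ {n} → (Fin n → Bool) → ℕ
count {n} P = sum (map (λ i → if P i then 1 else 0) (allFin n))

IsTournament : ∀ {n} → Digraph n → Set
IsTournament {n} T =
  (∀ u → T u u ≡ false) × (∀ u v → u ≢ v → T u v ≡ not (T v u))

Arc : ∀ {n} → Digraph n → Fin n → Fin n → Set
Arc T u v = T u v ≡ true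

Acyclic : ∀ {n} → (Fin n → Fin n → Set) → Set
Acyclic {n} R = ∀ (v : Fin n) → ¬ TransClosure R v v

IsFAS : ∀ {n} → Digraph n → Digraph n → Set
IsFAS T F =
  (∀ u v → F u v ≡ true → T u v ≡ true) ×
  Acyclic (λ u v → (T u v ≡ true) × (F u v ≡ false))

arcCount : ∀ {n} → Digraph n → ℕ
arcCount {n} F = sum (map (λ u → count (λ v → F u v)) (allFin n))

MinFASSize : ∀ {n} → Digraph n → ℕ → Set
MinFASSize T k =
  Σ _ (λ F → IsFAS T F × arcCount F ≡ k) ×
  (∀ F → IsFAS T F → k ≤ arcCount F)

triangles : ∀ {n} → Digraph n → Fin n → Fin n → ℕ
triangles T u v = count (λ w → T v w ∧ T w u)

-- Throughout, t = 3√k.  For a natural number c,  c ≥ 3√k  ⇔  9k ≤ c².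
atLeastT : ℕ → ℕ → Bool
atLeastT k c = (9 * k) ≤ᵇ (c * c)

majorSuspect : ∀ {n} → Digraph n → ℕ → Fin n → Fin n → Bool
majorSuspect T k u v = T u v ∧ atLeastT k (triangles T u v)

bad : ∀ {n} → Digraph n → ℕ → Fin n → Bool
bad T k v =
  atLeastT k (count (λ w → majorSuspect T k v w ∨ majorSuspect T k w v))

indegree : ∀ {n} → Digraph n → Fin n → ℕ
indegree T v = count (λ u → T u v)

-- d = 12√k.  For naturals x, i:  x ∈ [i-d, i+d]  ⇔  |x - i| ≤ 12√k
--   ⇔  |x - i|² ≤ 144k.
withinD : ℕ → ℕ → ℕ → Bool
withinD k i x = (∣ x - i ∣ * ∣ x - i ∣) ≤ᵇ (144 * k)

inC : ∀ {n} → Digraph n → ℕ → ℕ → Fin n → Bool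
inC T k i v = withinD k i (indegree T v) ∨ bad T k v

-- Fix a feedback arc set F with |F| = k.  T − F is acyclic, so it has
-- a topological order; let rank v be the position of v in it.  Every arc of T running against the
-- order lies in F, so |indeg v − rank v| ≤ f(v), the number of F-arcs at v, and Σ f = 2k.
-- A triangle through an arc uv ∉ F contains an F-arc at u or at v.  Hence a major suspect at a
-- vertex x with f(x) < √k is in F or ends in a vertex with f > 2√k; by averaging there are at most
-- √k + 1 such vertices, so x has fewer than 3√k major suspects: every bad vertex has f ≥ √k.
-- At most 2√k vertices have f ≥ √k, and every other vertex of C(i) has rank within 13√k of i;
-- ranks being distinct, |C(i)| ≤ 2√k + 26√k.  Formally √k and 12√k are replaced by ⌊√k⌋ and
-- ⌊√(144k)⌋, which costs the slack up to 52√k.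

module Submission where

open import Defs
open import Data.Bool using (Bool; true; false; if_then_else_; _∧_; _∨_; not)
import Data.Bool.Properties as Bool
open import Data.Bool.Properties using (T-≡; ∨-zeroʳ; ∧-identityʳ)
open import Data.Empty using (⊥-elim)
open import Data.Fin using (Fin; zero; suc; toℕ; punchIn; punchOut)
import Data.Fin.Properties as Fin
open import Data.List using (map; allFin; tabulate)
open import Data.List.Properties using (map-tabulate)
open import Data.Nat
open import Data.Nat.Properties
open import Algebra.Properties.CommutativeMonoid.Sum +-0-commutativeMonoid
  using (sum-syntax; sum-cong-≗; ∑-distrib-+; ∑-comm)
open import Data.Nat.GeneralisedArithmetic using (fold)
open import Data.Nat.Tactic.RingSolver using (solve-∀)
import Data.Nat.ListAction as List
open import Data.Product using (∃-syntax; _×_; _,_; proj₁; proj₂)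
open import Data.Sum using (_⊎_; inj₁; inj₂)
open import Function using (_∘_; id; Equivalence)
open import Relation.Binary.PropositionalEquality
open import Relation.Binary.Construct.Closure.Transitive using (TransClosure; [_]; _∷_)
open import Relation.Binary.Definitions using (Decidable; tri<; tri≈; tri>)
open import Relation.Nullary using (¬_; yes; no; Dec; ¬?; _×-dec_)
open import Relation.Nullary.Decidable using (decidable-stable)

∧≡true⇒ : ∀ a {b} → a ∧ b ≡ true → a ≡ true × b ≡ true
∧≡true⇒ true e = refl , e

∨≡true⇒ : ∀ a {b} → a ∨ b ≡ true → a ≡ true ⊎ b ≡ true
∨≡true⇒ true  _ = inj₁ refl
∨≡true⇒ false e = inj₂ e

not≡true⇒≢true : ∀ {b} → not b ≡ true → ¬ b ≡ true
not≡true⇒≢true {false} _ ()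

module _ {m n : ℕ} where

  ≤ᵇ≡true⇒≤ : (m ≤ᵇ n) ≡ true → m ≤ n
  ≤ᵇ≡true⇒≤ = ≤ᵇ⇒≤ m n ∘ Equivalence.from T-≡

  ≤⇒≤ᵇ≡true : m ≤ n → (m ≤ᵇ n) ≡ true
  ≤⇒≤ᵇ≡true = Equivalence.to T-≡ ∘ ≤⇒≤ᵇ

  <ᵇ≡true⇒< : (m <ᵇ n) ≡ true → m < n
  <ᵇ≡true⇒< = <ᵇ⇒< m n ∘ Equivalence.from T-≡

  <⇒<ᵇ≡true : m < n → (m <ᵇ n) ≡ true
  <⇒<ᵇ≡true = Equivalence.to T-≡ ∘ <⇒<ᵇ

  ≡ᵇ≡true⇒≡ : (m ≡ᵇ n) ≡ true → m ≡ n
  ≡ᵇ≡true⇒≡ = ≡ᵇ⇒≡ m n ∘ Equivalence.from T-≡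

  ≡⇒≡ᵇ≡true : m ≡ n → (m ≡ᵇ n) ≡ true
  ≡⇒≡ᵇ≡true = Equivalence.to T-≡ ∘ ≡⇒≡ᵇ m n

m*m≤n*n⇒m≤n : ∀ {m n} → m * m ≤ n * n → m ≤ n
m*m≤n*n⇒m≤n m²≤n² = ≮⇒≥ (λ n<m → <⇒≱ (*-mono-< n<m n<m) m²≤n²)

m*m<n*n⇒m<n : ∀ {m n} → m * m < n * n → m < n
m*m<n*n⇒m<n m²<n² = ≰⇒> (λ n≤m → <⇒≱ m²<n² (*-mono-≤ n≤m n≤m))

floorSqrt : ∀ m → ∃[ r ] r * r ≤ m × m < suc r * suc r
floorSqrt zero = 0 , z≤n , s≤s z≤n
floorSqrt (suc m) with floorSqrt m
... | r , r²≤m , m<[1+r]² with suc r * suc r ≤? suc m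
...   | yes [1+r]²≤1+m = suc r , [1+r]²≤1+m , ≤-<-trans m<[1+r]² (*-mono-< (n<1+n (suc r)) (n<1+n (suc r)))
...   | no  [1+r]²≰1+m = r , m≤n⇒m≤1+n r²≤m , ≰⇒> [1+r]²≰1+m

2*m*n≤m*m+n*n : ∀ m n → 2 * m * n ≤ m * m + n * n
2*m*n≤m*m+n*n zero    n       = z≤n
2*m*n≤m*m+n*n (suc m) zero    = ≤-trans (≤-reflexive (*-zeroʳ (2 * suc m))) z≤n
2*m*n≤m*m+n*n (suc m) (suc n) = begin
  2 * suc m * suc n                    ≡⟨ lhs m n ⟩
  2 * m * n + (2 * m + 2 * n + 2)      ≤⟨ +-monoˡ-≤ _ (2*m*n≤m*m+n*n m n) ⟩
  m * m + n * n + (2 * m + 2 * n + 2)  ≡⟨ rhs m n ⟩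
  suc m * suc m + suc n * suc n        ∎
  where
  open ≤-Reasoning
  lhs : ∀ m n → 2 * suc m * suc n ≡ 2 * m * n + (2 * m + 2 * n + 2)
  lhs = solve-∀
  rhs : ∀ m n → m * m + n * n + (2 * m + 2 * n + 2) ≡ suc m * suc m + suc n * suc n
  rhs = solve-∀

m≤n+o⇒n≤m+o⇒∣m-n∣≤o : ∀ {m n o} → m ≤ n + o → n ≤ m + o → ∣ m - n ∣ ≤ o
m≤n+o⇒n≤m+o⇒∣m-n∣≤o {m} {n} m≤n+o n≤m+o with ∣m-n∣≡[m∸n]∨[n∸m] m n
... | inj₁ ∣m-n∣≡m∸n = subst (_≤ _) (sym ∣m-n∣≡m∸n) (m≤n+o⇒m∸n≤o m n m≤n+o)
... | inj₂ ∣m-n∣≡n∸m = subst (_≤ _) (sym ∣m-n∣≡n∸m) (m≤n+o⇒m∸n≤o n m n≤m+o)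

[a+b+c]²≤3[a²+b²+c²] : ∀ a b c → (a + b + c) * (a + b + c) ≤ 3 * (a * a + b * b + c * c)
[a+b+c]²≤3[a²+b²+c²] a b c = begin
  (a + b + c) * (a + b + c)                                  ≡⟨ expand a b c ⟩
  a * a + b * b + c * c + (2 * a * b + 2 * b * c + 2 * c * a)  ≤⟨ +-monoʳ-≤ (a * a + b * b + c * c)
    (+-mono-≤ (+-mono-≤ (2*m*n≤m*m+n*n a b) (2*m*n≤m*m+n*n b c)) (2*m*n≤m*m+n*n c a)) ⟩
  a * a + b * b + c * c + ((a * a + b * b) + (b * b + c * c) + (c * c + a * a)) ≡⟨ collect a b c ⟩
  3 * (a * a + b * b + c * c)                                ∎
  where
  open ≤-Reasoning
  expand : ∀ a b c → (a + b + c) * (a + b + c) ≡ a * a + b * b + c * c + (2 * a * b + 2 * b * c + 2 * c * a)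
  expand = solve-∀
  collect : ∀ a b c → a * a + b * b + c * c + ((a * a + b * b) + (b * b + c * c) + (c * c + a * a)) ≡ 3 * (a * a + b * b + c * c)
  collect = solve-∀

𝟙 : Bool → ℕ
𝟙 b = if b then 1 else 0

listSum-allFin : ∀ {n} (f : Fin n → ℕ) → List.sum (map f (allFin n)) ≡ ∑[ i < n ] f i
listSum-allFin {n} f = trans (cong List.sum (map-tabulate id f)) (go f)
  where
  go : ∀ {m} (g : Fin m → ℕ) → List.sum (tabulate g) ≡ ∑[ i < m ] g i
  go {zero}  g = refl
  go {suc m} g = cong (g zero +_) (go (g ∘ suc))

count≡∑ : ∀ {n} (P : Fin n → Bool) → count P ≡ ∑[ i < n ] 𝟙 (P i)
count≡∑ P = listSum-allFin (λ i → 𝟙 (P i))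

∑-mono-≤ : ∀ {n} {f g : Fin n → ℕ} → (∀ i → f i ≤ g i) → ∑[ i < n ] f i ≤ ∑[ i < n ] g i
∑-mono-≤ {zero}  f≤g = z≤n
∑-mono-≤ {suc n} f≤g = +-mono-≤ (f≤g zero) (∑-mono-≤ (f≤g ∘ suc))

module _ {n : ℕ} where

  count-union-bound : (P Q R : Fin n → Bool) →
    (∀ i → P i ≡ true → Q i ≡ true ⊎ R i ≡ true) → count P ≤ count Q + count R
  count-union-bound P Q R P⊆Q∪R = begin
    count P                                       ≡⟨ count≡∑ P ⟩
    ∑[ i < n ] 𝟙 (P i)                            ≤⟨ ∑-mono-≤ (λ i → pointwise (P⊆Q∪R i)) ⟩
    ∑[ i < n ] (𝟙 (Q i) + 𝟙 (R i))                ≡⟨ ∑-distrib-+ (𝟙 ∘ Q) (𝟙 ∘ R) ⟩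
    ∑[ i < n ] 𝟙 (Q i) + ∑[ i < n ] 𝟙 (R i)       ≡⟨ sym (cong₂ _+_ (count≡∑ Q) (count≡∑ R)) ⟩
    count Q + count R                             ∎
    where
    open ≤-Reasoning
    pointwise : ∀ {p q r} → (p ≡ true → q ≡ true ⊎ r ≡ true) → 𝟙 p ≤ 𝟙 q + 𝟙 r
    pointwise {false}                 _ = z≤n
    pointwise {true} {q} p⇒q∨r with p⇒q∨r refl
    ... | inj₁ refl = s≤s z≤n
    ... | inj₂ refl = m≤n+m 1 (𝟙 q)

  count-markov : (P : Fin n → Bool) (f : Fin n → ℕ) (q : ℕ) →
    (∀ i → P i ≡ true → q ≤ f i) → count P * q ≤ ∑[ i < n ] f i
  count-markov P f q q≤f rewrite count≡∑ P = go P f q≤f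
    where
    go : ∀ {m} (P : Fin m → Bool) (f : Fin m → ℕ) →
      (∀ i → P i ≡ true → q ≤ f i) → (∑[ i < m ] 𝟙 (P i)) * q ≤ ∑[ i < m ] f i
    go {zero}  P f q≤f = z≤n
    go {suc m} P f q≤f rewrite *-distribʳ-+ q (𝟙 (P zero)) (∑[ i < m ] 𝟙 (P (suc i))) =
      +-mono-≤ (head (P zero) (q≤f zero)) (go (P ∘ suc) (f ∘ suc) (q≤f ∘ suc))
      where
      head : ∀ b {x} → (b ≡ true → q ≤ x) → 𝟙 b * q ≤ x
      head false _   = z≤n
      head true  q≤x = subst (_≤ _) (sym (+-identityʳ q)) (q≤x refl)

𝟙-mono : ∀ {p q} → (p ≡ true → q ≡ true) → 𝟙 p ≤ 𝟙 q
𝟙-mono {false}     _   = z≤n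
𝟙-mono {true}  p⇒q rewrite p⇒q refl = ≤-refl

∑𝟙-none : ∀ {n} (P : Fin n → Bool) → (∀ i → ¬ P i ≡ true) → ∑[ i < n ] 𝟙 (P i) ≡ 0
∑𝟙-none {zero}  P ¬P = refl
∑𝟙-none {suc n} P ¬P with P zero in P0
... | true  = ⊥-elim (¬P zero P0)
... | false = ∑𝟙-none (P ∘ suc) (¬P ∘ suc)

module _ {n : ℕ} where

  count-none : (P : Fin n → Bool) → (∀ i → ¬ P i ≡ true) → count P ≡ 0
  count-none P ¬P = trans (count≡∑ P) (∑𝟙-none P ¬P)

  count-atMostOne : (P : Fin n → Bool) →
    (∀ i j → P i ≡ true → P j ≡ true → i ≡ j) → count P ≤ 1
  count-atMostOne P unique rewrite count≡∑ P = go P unique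
    where
    go : ∀ {m} (P : Fin m → Bool) →
      (∀ i j → P i ≡ true → P j ≡ true → i ≡ j) → ∑[ i < m ] 𝟙 (P i) ≤ 1
    go {zero}  P unique = z≤n
    go {suc m} P unique with P zero in P0
    ... | false = go (P ∘ suc) (λ i j Pi Pj → Fin.suc-injective (unique _ _ Pi Pj))
    ... | true  = s≤s (≤-reflexive (∑𝟙-none (P ∘ suc) (λ i Pi → 0≢suc (unique _ _ P0 Pi))))
      where
      0≢suc : ∀ {i : Fin m} → ¬ zero ≡ suc i
      0≢suc ()

  count-< : (P Q : Fin n → Bool) → (∀ i → P i ≡ true → Q i ≡ true) →
    ∀ j → ¬ P j ≡ true → Q j ≡ true → count P < count Q
  count-< P Q P⊆Q j ¬Pj Qj rewrite count≡∑ P | count≡∑ Q = go P Q P⊆Q j ¬Pj Qj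
    where
    go : ∀ {m} (P Q : Fin m → Bool) → (∀ i → P i ≡ true → Q i ≡ true) →
      ∀ j → ¬ P j ≡ true → Q j ≡ true → ∑[ i < m ] 𝟙 (P i) < ∑[ i < m ] 𝟙 (Q i)
    go P Q P⊆Q zero ¬Pj Qj with P zero
    ... | true  = ⊥-elim (¬Pj refl)
    ... | false rewrite Qj = s≤s (∑-mono-≤ (λ i → 𝟙-mono (P⊆Q (suc i))))
    go P Q P⊆Q (suc j) ¬Pj Qj =
      +-mono-≤-< (𝟙-mono (P⊆Q zero)) (go (P ∘ suc) (Q ∘ suc) (P⊆Q ∘ suc) j ¬Pj Qj)

  module _ (p : Fin n → ℕ) (p-injective : ∀ {u v} → p u ≡ p v → u ≡ v) where

    count-injective-interval : ∀ m a (P : Fin n → Bool) →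
      (∀ v → P v ≡ true → a ≤ p v × p v < a + m) → count P ≤ m
    count-injective-interval zero a P inside =
      ≤-reflexive (count-none P (λ v Pv → let a≤p , p<a+0 = inside v Pv in
        <⇒≱ p<a+0 (≤-trans (≤-reflexive (+-identityʳ a)) a≤p)))
    count-injective-interval (suc m) a P inside = begin
      count P                                    ≤⟨ count-union-bound P atA aboveA split ⟩
      count atA + count aboveA                   ≤⟨ +-mono-≤ one (count-injective-interval m (suc a) aboveA rest) ⟩
      1 + m                                      ∎
      where
      open ≤-Reasoning
      atA aboveA : Fin n → Bool
      atA    v = p v ≡ᵇ a
      aboveA v = P v ∧ (a <ᵇ p v)
      split : ∀ v → P v ≡ true → atA v ≡ true ⊎ aboveA v ≡ true
      split v Pv with m≤n⇒m<n∨m≡n (proj₁ (inside v Pv))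
      ... | inj₁ a<p = inj₂ (cong₂ _∧_ Pv (<⇒<ᵇ≡true a<p))
      ... | inj₂ a≡p = inj₁ (≡⇒≡ᵇ≡true (sym a≡p))
      one : count atA ≤ 1
      one = count-atMostOne atA (λ u v pu≡a pv≡a →
        p-injective (trans (≡ᵇ≡true⇒≡ pu≡a) (sym (≡ᵇ≡true⇒≡ pv≡a))))
      rest : ∀ v → aboveA v ≡ true → suc a ≤ p v × p v < suc a + m
      rest v e with P v in Pv | a <ᵇ p v in a<p
      rest v refl | true | true =
        <ᵇ≡true⇒< a<p ,
        subst (p v <_) (+-suc a m) (proj₂ (inside v Pv))

    count-injective-ball : ∀ c r (P : Fin n → Bool) →
      (∀ v → P v ≡ true → ∣ p v - c ∣ < r) → count P ≤ 2 * r
    count-injective-ball c r P near = count-injective-interval (2 * r) (c ∸ r) P bounds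
      where
      bounds : ∀ v → P v ≡ true → c ∸ r ≤ p v × p v < c ∸ r + 2 * r
      bounds v Pv = m≤n+o⇒m∸n≤o c r c≤r+p , p<
        where
        open ≤-Reasoning
        d<r : ∣ p v - c ∣ < r
        d<r = near v Pv
        c≤r+p : c ≤ r + p v
        c≤r+p = begin
          c                 ≤⟨ m≤∣m-n∣+n c (p v) ⟩
          ∣ c - p v ∣ + p v  ≡⟨ cong (_+ p v) (∣-∣-comm c (p v)) ⟩
          ∣ p v - c ∣ + p v  ≤⟨ +-monoˡ-≤ (p v) (<⇒≤ d<r) ⟩
          r + p v           ∎
        p< : p v < c ∸ r + 2 * r
        p< = begin-strict
          p v                    ≤⟨ m≤n+∣m-n∣ (p v) c ⟩
          c + ∣ p v - c ∣         <⟨ +-monoʳ-< c d<r ⟩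
          c + r                  ≤⟨ +-monoˡ-≤ r (m≤n+m∸n c r) ⟩
          r + (c ∸ r) + r        ≡⟨ shuffle r (c ∸ r) ⟩
          c ∸ r + 2 * r          ∎
          where
          shuffle : ∀ r x → r + x + r ≡ x + 2 * r
          shuffle = solve-∀

TransClosure-map : ∀ {A B : Set} {R : A → A → Set} {S : B → B → Set} (f : A → B) →
  (∀ {x y} → R x y → S (f x) (f y)) → ∀ {x y} → TransClosure R x y → TransClosure S (f x) (f y)
TransClosure-map f R⇒S [ r ]     = [ R⇒S r ]
TransClosure-map f R⇒S (r ∷ rs) = R⇒S r ∷ TransClosure-map f R⇒S rs

iterate-path : ∀ {A : Set} {R : A → A → Set} (prev : A → A) → (∀ v → R (prev v) v) →
  ∀ x d j → TransClosure R (fold x prev (suc d + j)) (fold x prev j)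
iterate-path prev R-prev x zero    j = [ R-prev _ ]
iterate-path prev R-prev x (suc d) j = R-prev _ ∷ iterate-path prev R-prev x d j

module _ {n : ℕ} {R : Fin (suc n) → Fin (suc n) → Set} where

  predecessors⇒cycle : (prev : Fin (suc n) → Fin (suc n)) → (∀ v → R (prev v) v) →
    ∃[ v ] TransClosure R v v
  predecessors⇒cycle prev R-prev with Fin.pigeonhole (n<1+n (suc n)) (fold zero prev ∘ toℕ)
  ... | i , j , i<j , walk-i≡walk-j =
    fold zero prev (toℕ j) , subst (TransClosure R _) walk-i≡walk-j
      (subst (λ m → TransClosure R (fold zero prev m) _)
        (trans (sym (+-suc _ (toℕ i))) (m∸n+n≡m i<j))
        (iterate-path prev R-prev zero (toℕ j ∸ suc (toℕ i)) (toℕ i)))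

  acyclic⇒source : Decidable R → Acyclic R → ∃[ s ] ∀ w → ¬ R w s
  acyclic⇒source R? acyclic with Fin.any? (λ s → Fin.all? (λ w → ¬? (R? w s)))
  ... | yes source = source
  ... | no ¬source = ⊥-elim (acyclic _ (proj₂ (predecessors⇒cycle (proj₁ ∘ has-pred) (proj₂ ∘ has-pred))))
    where
    has-pred : ∀ v → ∃[ w ] R w v
    has-pred v with Fin.¬∀⟶∃¬ _ _ (λ w → ¬? (R? w v)) (λ none → ¬source (v , none))
    ... | w , ¬¬Rwv = w , decidable-stable (R? w v) ¬¬Rwv

record TopologicalOrder {n : ℕ} (R : Fin n → Fin n → Set) : Set where
  field
    key           : Fin n → ℕ
    key-injective : ∀ {u v} → key u ≡ key v → u ≡ v
    key-monotone  : ∀ {u v} → R u v → key u < key v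

topologicalOrder : ∀ {n} {R : Fin n → Fin n → Set} → Decidable R → Acyclic R → TopologicalOrder R
topologicalOrder {zero} _ _ = record
  { key = λ () ; key-injective = λ { {()} } ; key-monotone = λ { {()} } }
topologicalOrder {suc n} {R} R? acyclic with acyclic⇒source R? acyclic
... | s , s-source = record { key = key ; key-injective = injective ; key-monotone = monotone }
  where
  module Rest = TopologicalOrder
    (topologicalOrder (λ u v → R? _ _) (λ v cyc → acyclic _ (TransClosure-map (punchIn s) id cyc)))
  keyOf : ∀ v → Dec (s ≡ v) → ℕ
  keyOf v (yes _)  = 0
  keyOf v (no s≢v) = suc (Rest.key (punchOut s≢v))
  key : Fin (suc n) → ℕ
  key v = keyOf v (s Fin.≟ v)
  injective : ∀ {u v} → key u ≡ key v → u ≡ v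
  injective {u} {v} eq with s Fin.≟ u | s Fin.≟ v | eq
  ... | yes s≡u | yes s≡v | _   = trans (sym s≡u) s≡v
  ... | yes _   | no _    | ()
  ... | no _    | yes _   | ()
  ... | no s≢u  | no s≢v  | eq′ = Fin.punchOut-injective s≢u s≢v (Rest.key-injective (suc-injective eq′))
  monotone : ∀ {u v} → R u v → key u < key v
  monotone {u} {v} Ruv with s Fin.≟ u | s Fin.≟ v
  ... | _       | yes refl = ⊥-elim (s-source u Ruv)
  ... | yes _   | no _     = s≤s z≤n
  ... | no s≢u  | no s≢v   = s≤s (Rest.key-monotone
    (subst₂ R (sym (Fin.punchIn-punchOut s≢u)) (sym (Fin.punchIn-punchOut s≢v)) Ruv))

module FeedbackArcSet {n : ℕ} {T F : Digraph n} (fas : IsFAS T F) where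

  _⇾_ : Fin n → Fin n → Set
  u ⇾ v = (T u v ≡ true) × (F u v ≡ false)

  ⇾-acyclic : Acyclic _⇾_
  ⇾-acyclic = proj₂ fas

  fasDegree : Fin n → ℕ
  fasDegree v = count (λ w → F v w ∨ F w v)

  ∑fasDegree≤2*arcCount : ∑[ v < n ] fasDegree v ≤ 2 * arcCount F
  ∑fasDegree≤2*arcCount = begin
    ∑[ v < n ] fasDegree v
      ≤⟨ ∑-mono-≤ (λ v → count-union-bound _ (F v) (λ w → F w v) (λ w → ∨≡true⇒ (F v w))) ⟩
    ∑[ v < n ] (count (F v) + count (λ w → F w v))
      ≡⟨ ∑-distrib-+ (count ∘ F) _ ⟩
    ∑[ v < n ] count (F v) + ∑[ v < n ] count (λ w → F w v)
      ≡⟨ cong (∑[ v < n ] count (F v) +_) in-arcs ⟩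
    ∑[ v < n ] count (F v) + ∑[ v < n ] count (F v)
      ≡⟨ cong₂ _+_ arcs arcs ⟩
    arcCount F + arcCount F
      ≡⟨ cong (arcCount F +_) (sym (+-identityʳ (arcCount F))) ⟩
    2 * arcCount F ∎
    where
    open ≤-Reasoning
    arcs : ∑[ v < n ] count (F v) ≡ arcCount F
    arcs = sym (listSum-allFin (count ∘ F))
    in-arcs : ∑[ v < n ] count (λ w → F w v) ≡ ∑[ v < n ] count (F v)
    in-arcs = begin-equality
      ∑[ v < n ] count (λ w → F w v)     ≡⟨ sum-cong-≗ (λ v → count≡∑ (λ w → F w v)) ⟩
      ∑[ v < n ] ∑[ w < n ] 𝟙 (F w v)   ≡⟨ ∑-comm (λ v w → 𝟙 (F w v)) ⟩
      ∑[ w < n ] ∑[ v < n ] 𝟙 (F w v)   ≡⟨ sum-cong-≗ (λ w → sym (count≡∑ (F w))) ⟩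
      ∑[ w < n ] count (F w)            ∎

  triangles≤fasDegree+fasDegree : ∀ {u v} → u ⇾ v → triangles T u v ≤ fasDegree v + fasDegree u
  triangles≤fasDegree+fasDegree {u} {v} u⇾v =
    count-union-bound _ _ _ (λ w Tvw∧Twu → FAS-arc-in-triangle w (∧≡true⇒ (T v w) Tvw∧Twu))
    where
    FAS-arc-in-triangle : ∀ w → T v w ≡ true × T w u ≡ true →
      (F v w ∨ F w v) ≡ true ⊎ (F u w ∨ F w u) ≡ true
    FAS-arc-in-triangle w (Tvw , Twu) with F v w in Fvw | F w u in Fwu
    ... | true  | _     = inj₁ refl
    ... | false | true  = inj₂ (∨-zeroʳ (F u w))
    ... | false | false = ⊥-elim (⇾-acyclic u (u⇾v ∷ (Tvw , Fvw) ∷ [ Twu , Fwu ]))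

  _⇾?_ : Decidable _⇾_
  u ⇾? v = (T u v Bool.≟ true) ×-dec (F u v Bool.≟ false)

  open TopologicalOrder (topologicalOrder _⇾?_ ⇾-acyclic)

  rank : Fin n → ℕ
  rank v = count (λ w → key w <ᵇ key v)

  rank-monotone : ∀ {u v} → key u < key v → rank u < rank v
  rank-monotone {u} {v} ku<kv = count-< _ _
    (λ w kw<ku → <⇒<ᵇ≡true (<-trans (<ᵇ≡true⇒< kw<ku) ku<kv))
    u (<-irrefl refl ∘ <ᵇ≡true⇒< {key u}) (<⇒<ᵇ≡true ku<kv)

  rank-injective : ∀ {u v} → rank u ≡ rank v → u ≡ v
  rank-injective {u} {v} ru≡rv with <-cmp (key u) (key v)
  ... | tri< ku<kv _ _ = ⊥-elim (<-irrefl ru≡rv (rank-monotone ku<kv))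
  ... | tri≈ _ ku≡kv _ = key-injective ku≡kv
  ... | tri> _ _ kv<ku = ⊥-elim (<-irrefl (sym ru≡rv) (rank-monotone kv<ku))

  indegree≤rank+fasDegree : ∀ v → indegree T v ≤ rank v + fasDegree v
  indegree≤rank+fasDegree v = count-union-bound _ _ _ in-neighbour
    where
    in-neighbour : ∀ w → T w v ≡ true → (key w <ᵇ key v) ≡ true ⊎ (F v w ∨ F w v) ≡ true
    in-neighbour w Twv with F w v in Fwv
    ... | true  = inj₂ (∨-zeroʳ (F v w))
    ... | false = inj₁ (<⇒<ᵇ≡true (key-monotone (Twv , Fwv)))

  module _ (tournament : IsTournament T) where

    rank≤indegree+fasDegree : ∀ v → rank v ≤ indegree T v + fasDegree v
    rank≤indegree+fasDegree v = count-union-bound _ _ _ earlier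
      where
      earlier : ∀ w → (key w <ᵇ key v) ≡ true → T w v ≡ true ⊎ (F v w ∨ F w v) ≡ true
      earlier w kw<kv with T w v in Twv
      ... | true  = inj₁ refl
      ... | false with F v w in Fvw
      ...   | true  = inj₂ refl
      ...   | false = ⊥-elim (<-asym (<ᵇ≡true⇒< kw<kv) (key-monotone (Tvw , Fvw)))
        where
        v≢w : v ≢ w
        v≢w refl = <-irrefl refl (<ᵇ≡true⇒< {key v} kw<kv)
        Tvw : T v w ≡ true
        Tvw = trans (proj₂ tournament v w v≢w) (cong not Twv)

    ∣rank-indegree∣≤fasDegree : ∀ v → ∣ rank v - indegree T v ∣ ≤ fasDegree v
    ∣rank-indegree∣≤fasDegree v =
      m≤n+o⇒n≤m+o⇒∣m-n∣≤o (rank≤indegree+fasDegree v) (indegree≤rank+fasDegree v)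

module _ {n : ℕ} {T F : Digraph n} (tournament : IsTournament T) (fas : IsFAS T F)
         {k : ℕ} (|F|≡k : arcCount F ≡ k) (1≤k : 1 ≤ k) where

  open FeedbackArcSet fas

  s : ℕ
  s = proj₁ (floorSqrt k)

  s²≤k : s * s ≤ k
  s²≤k = proj₁ (proj₂ (floorSqrt k))

  k<[1+s]² : k < suc s * suc s
  k<[1+s]² = proj₂ (proj₂ (floorSqrt k))

  1≤s : 1 ≤ s
  1≤s = s≤s⁻¹ (m*m<n*n⇒m<n (≤-<-trans 1≤k k<[1+s]²))

  ∑fasDegree≤2k : ∑[ v < n ] fasDegree v ≤ 2 * k
  ∑fasDegree≤2k = subst (λ m → _ ≤ 2 * m) |F|≡k ∑fasDegree≤2*arcCount

  atLeastT⇒3s≤ : ∀ c → atLeastT k c ≡ true → 3 * s ≤ c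
  atLeastT⇒3s≤ c 9k≤c² = m*m≤n*n⇒m≤n (begin
    3 * s * (3 * s)  ≡⟨ square s ⟩
    9 * (s * s)      ≤⟨ *-monoʳ-≤ 9 s²≤k ⟩
    9 * k            ≤⟨ ≤ᵇ≡true⇒≤ 9k≤c² ⟩
    c * c            ∎)
    where
    open ≤-Reasoning
    square : ∀ s → 3 * s * (3 * s) ≡ 9 * (s * s)
    square = solve-∀

  -- the possible far endpoints of a major suspect outside F at a vertex with f < s
  veryHigh : Fin n → Bool
  veryHigh w = 2 * s + 1 ≤ᵇ fasDegree w

  count-veryHigh≤1+s : count veryHigh ≤ 1 + s
  count-veryHigh≤1+s = m<1+n⇒m≤n (*-cancelʳ-< (2 * s + 1) _ _ (begin-strict
    count veryHigh * (2 * s + 1)  ≤⟨ count-markov veryHigh fasDegree _ (λ w → ≤ᵇ≡true⇒≤) ⟩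
    ∑[ v < n ] fasDegree v        ≤⟨ ∑fasDegree≤2k ⟩
    2 * k                         <⟨ *-monoʳ-< 2 k<[1+s]² ⟩
    2 * (suc s * suc s)           ≤⟨ m≤m+n _ s ⟩
    2 * (suc s * suc s) + s       ≡⟨ expand s ⟩
    (2 + s) * (2 * s + 1)         ∎))
    where
    open ≤-Reasoning
    expand : ∀ s → 2 * (suc s * suc s) + s ≡ (2 + s) * (2 * s + 1)
    expand = solve-∀

  majorSuspect⇒3s≤fasDegree+fasDegree : ∀ {u v} → majorSuspect T k u v ≡ true → F u v ≡ false →
    3 * s ≤ fasDegree v + fasDegree u
  majorSuspect⇒3s≤fasDegree+fasDegree {u} {v} suspect Fuv =
    let Tuv , many = ∧≡true⇒ (T u v) suspect in
    ≤-trans (atLeastT⇒3s≤ _ many) (triangles≤fasDegree+fasDegree (Tuv , Fuv))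

  bad⇒s≤fasDegree : ∀ x → bad T k x ≡ true → s ≤ fasDegree x
  bad⇒s≤fasDegree x badx = ≮⇒≥ λ fx<s → <-irrefl refl (begin-strict
    3 * s                          ≤⟨ atLeastT⇒3s≤ _ badx ⟩
    count suspectAtX               ≤⟨ count-union-bound _ _ _ (FAS-or-veryHigh fx<s) ⟩
    fasDegree x + count veryHigh   <⟨ +-mono-<-≤ fx<s count-veryHigh≤1+s ⟩
    s + (1 + s)                    ≤⟨ +-monoʳ-≤ s (+-monoˡ-≤ s 1≤s) ⟩
    s + (s + s)                    ≡⟨ triple s ⟩
    3 * s                          ∎)
    where
    open ≤-Reasoning
    triple : ∀ s → s + (s + s) ≡ 3 * s
    triple = solve-∀
    suspectAtX : Fin n → Bool
    suspectAtX w = majorSuspect T k x w ∨ majorSuspect T k w x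
    veryHigh-end : ∀ {w} → fasDegree x < s → 3 * s ≤ fasDegree w + fasDegree x → veryHigh w ≡ true
    veryHigh-end {w} fx<s 3s≤fw+fx = ≤⇒≤ᵇ≡true (+-cancelʳ-≤ (fasDegree x) _ _ (begin
      2 * s + 1 + fasDegree x   ≡⟨ +-assoc (2 * s) 1 _ ⟩
      2 * s + suc (fasDegree x) ≤⟨ +-monoʳ-≤ (2 * s) fx<s ⟩
      2 * s + s                 ≡⟨ +-comm (2 * s) s ⟩
      3 * s                     ≤⟨ 3s≤fw+fx ⟩
      fasDegree w + fasDegree x ∎))
    FAS-or-veryHigh : fasDegree x < s → ∀ w → suspectAtX w ≡ true →
      (F x w ∨ F w x) ≡ true ⊎ veryHigh w ≡ true
    FAS-or-veryHigh fx<s w suspect with F x w in Fxw | F w x in Fwx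
    ... | true  | _     = inj₁ refl
    ... | false | true  = inj₁ refl
    ... | false | false with ∨≡true⇒ (majorSuspect T k x w) suspect
    ...   | inj₁ xw = inj₂ (veryHigh-end fx<s (majorSuspect⇒3s≤fasDegree+fasDegree xw Fxw))
    ...   | inj₂ wx = inj₂ (veryHigh-end fx<s
      (subst (3 * s ≤_) (+-comm (fasDegree x) _) (majorSuspect⇒3s≤fasDegree+fasDegree wx Fwx)))

  high : Fin n → Bool
  high v = s ≤ᵇ fasDegree v

  count-high²≤16k : count high * count high ≤ 16 * k
  count-high²≤16k = *-cancelʳ-≤ _ _ k {{>-nonZero 1≤k}} (begin
    h * h * k                  ≤⟨ *-monoʳ-≤ (h * h) k≤4s² ⟩
    h * h * (4 * (s * s))      ≡⟨ regroup h s ⟩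
    4 * ((h * s) * (h * s))    ≤⟨ *-monoʳ-≤ 4 (*-mono-≤ h*s≤2k h*s≤2k) ⟩
    4 * ((2 * k) * (2 * k))    ≡⟨ regroup′ k ⟩
    16 * k * k                 ∎)
    where
    open ≤-Reasoning
    h : ℕ
    h = count high
    h*s≤2k : h * s ≤ 2 * k
    h*s≤2k = ≤-trans (count-markov high fasDegree s (λ v → ≤ᵇ≡true⇒≤)) ∑fasDegree≤2k
    k≤4s² : k ≤ 4 * (s * s)
    k≤4s² = ≤-trans (<⇒≤ k<[1+s]²) (≤-trans (*-mono-≤ 1+s≤2s 1+s≤2s) (≤-reflexive (square s)))
      where
      1+s≤2s : suc s ≤ 2 * s
      1+s≤2s = ≤-trans (+-monoˡ-≤ s 1≤s) (≤-reflexive (cong (s +_) (sym (+-identityʳ s))))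
      square : ∀ s → 2 * s * (2 * s) ≡ 4 * (s * s)
      square = solve-∀
    regroup : ∀ h s → h * h * (4 * (s * s)) ≡ 4 * ((h * s) * (h * s))
    regroup = solve-∀
    regroup′ : ∀ k → 4 * ((2 * k) * (2 * k)) ≡ 16 * k * k
    regroup′ = solve-∀

  d : ℕ
  d = proj₁ (floorSqrt (144 * k))

  d²≤144k : d * d ≤ 144 * k
  d²≤144k = proj₁ (proj₂ (floorSqrt (144 * k)))

  withinD⇒≤d : ∀ i x → withinD k i x ≡ true → ∣ x - i ∣ ≤ d
  withinD⇒≤d i x within =
    m<1+n⇒m≤n (m*m<n*n⇒m<n (≤-<-trans (≤ᵇ≡true⇒≤ within) (proj₂ (proj₂ (floorSqrt (144 * k))))))

  count-inC≤ : ∀ i → count (inC T k i) ≤ count high + 2 * d + 2 * s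
  count-inC≤ i = begin
    count (inC T k i)                ≤⟨ count-union-bound _ high nearLow high-or-nearLow ⟩
    count high + count nearLow       ≤⟨ +-monoʳ-≤ (count high)
                                          (count-injective-ball rank rank-injective i (s + d) nearLow close) ⟩
    count high + 2 * (s + d)         ≡⟨ distribute (count high) s d ⟩
    count high + 2 * d + 2 * s       ∎
    where
    open ≤-Reasoning
    distribute : ∀ h s d → h + 2 * (s + d) ≡ h + 2 * d + 2 * s
    distribute = solve-∀
    nearLow : Fin n → Bool
    nearLow v = inC T k i v ∧ not (high v)
    high-or-nearLow : ∀ v → inC T k i v ≡ true → high v ≡ true ⊎ nearLow v ≡ true
    high-or-nearLow v inCv with high v
    ... | true  = inj₁ refl
    ... | false = inj₂ (trans (∧-identityʳ _) inCv)
    close : ∀ v → nearLow v ≡ true → ∣ rank v - i ∣ < s + d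
    close v nearLowv with ∧≡true⇒ (inC T k i v) nearLowv
    ... | inCv , low with ∨≡true⇒ (withinD k i (indegree T v)) inCv
    ...   | inj₂ badv   = ⊥-elim (not≡true⇒≢true low (≤⇒≤ᵇ≡true (bad⇒s≤fasDegree v badv)))
    ...   | inj₁ within = begin-strict
      ∣ rank v - i ∣                                   ≤⟨ ∣-∣-triangle (rank v) (indegree T v) i ⟩
      ∣ rank v - indegree T v ∣ + ∣ indegree T v - i ∣  ≤⟨ +-mono-≤ (∣rank-indegree∣≤fasDegree tournament v)
                                                                   (withinD⇒≤d i (indegree T v) within) ⟩
      fasDegree v + d                                  <⟨ +-monoˡ-< d fv<s ⟩
      s + d                                            ∎
      where
      fv<s : fasDegree v < s
      fv<s = ≰⇒> (not≡true⇒≢true low ∘ ≤⇒≤ᵇ≡true)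

  |C|²≤2704k : ∀ i → count (inC T k i) * count (inC T k i) ≤ 2704 * k
  |C|²≤2704k i = begin
    count (inC T k i) * count (inC T k i)             ≤⟨ *-mono-≤ (count-inC≤ i) (count-inC≤ i) ⟩
    (h + 2 * d + 2 * s) * (h + 2 * d + 2 * s)         ≤⟨ [a+b+c]²≤3[a²+b²+c²] h (2 * d) (2 * s) ⟩
    3 * (h * h + 2 * d * (2 * d) + 2 * s * (2 * s))   ≡⟨ square h d s ⟩
    3 * (h * h + 4 * (d * d) + 4 * (s * s))           ≤⟨ *-monoʳ-≤ 3 (+-mono-≤ (+-mono-≤ count-high²≤16k
                                                          (*-monoʳ-≤ 4 d²≤144k)) (*-monoʳ-≤ 4 s²≤k)) ⟩
    3 * (16 * k + 4 * (144 * k) + 4 * k)              ≡⟨ collect k ⟩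
    1788 * k                                          ≤⟨ *-monoˡ-≤ k (m≤m+n 1788 916) ⟩
    2704 * k                                          ∎
    where
    open ≤-Reasoning
    h : ℕ
    h = count high
    square : ∀ h d s → 3 * (h * h + 2 * d * (2 * d) + 2 * s * (2 * s)) ≡ 3 * (h * h + 4 * (d * d) + 4 * (s * s))
    square = solve-∀
    collect : ∀ k → 3 * (16 * k + 4 * (144 * k) + 4 * k) ≡ 1788 * k
    collect = solve-∀

proposition3 : ∀ (n : ℕ) (T : Digraph n) (k : ℕ) →
    IsTournament T → MinFASSize T k → 1 ≤ k →
    ∀ (i : Fin n) →
    count (inC T k (toℕ i)) * count (inC T k (toℕ i)) ≤ 2704 * k
proposition3 n T k tournament ((F , fas , |F|≡k) , _) 1≤k i = |C|²≤2704k tournament fas |F|≡k 1≤k (toℕ i)
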